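{- Let $n\ge 3$ be an integer, let $(G,C)$ be a circuit graph on $n$ vertices, let $u,v\in V(C)$ be distinct, and let $e\in E(C)$, such that $u,e,v$ occur on $C$ in clockwise order. If $e=uv$ or $n=3$, then $G$ has a $C$-Tutte path $P$ between $u$ and $v$ such that $e\in E(P)$ and $$\beta_G(P)\le (n-6)/3+\tau_G(vu)+\tau_G(ue)+\tau_G(ev).$$
   Context: All graphs are finite and simple; $|G|$ denotes the number of vertices of $G$. For $k\ge1$, a $k$-separation in $G$ is a pair $(G_1,G_2)$ of subgraphs with $|V(G_1\cap G_2)|=k$, $G=G_1\cup G_2$, $E(G_1)\cap E(G_2)=\emptyset$, and $G_i\not\subseteq G_{3-i}$ for $i=1,2$. A $k$-cut is a set $S\subseteq V(G)$ with $|S|=k$ such that there is a separation $(G_1,G_2)$ with $V(G_1\cap G_2)=S$ and $G_i-G_{3-i}\neq\emptyset$ for $i=1,2$. For $H\subseteq G$, an $H$-bridge of $G$ is either the subgraph induced by a single edge of $E(G)\setminus E(H)$ with both ends in $H$, or the subgraph formed by the edges of $G$ incident with one or two vertices of a single component of $G-H$ (together with their ends). The vertices of $B\cap H$ are the attachments of the bridge $B$. $\beta_G(H)$ denotes the number of $H$-bridges $B$ of $G$ with $|B|\ge 3$. $H$ is a Tutte subgraph of $G$ if every $H$-bridge of $G$ has at most three attachments on $H$; for $F\subseteq G$, $H$ is an $F$-Tutte subgraph if it is a Tutte subgraph and every $H$-bridge of $G$ containing an edge of $F$ has at most two attachments on $H$. A ($F$-)Tutte path is a ($F$-)Tutte subgraph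 that is a path. $(G,C)$ is a circuit graph if $G$ is a 2-connected plane graph, $C$ is its outer cycle, and for every 2-cut $T$ of $G$ each component of $G-T$ contains a vertex of $C$. For distinct $x,y\in V(C)\cup E(C)$, $xCy$ denotes the subpath of $C$ going clockwise from $x$ to $y$ such that $x,y\notin E(xCy)$. $xCy$ is good if $G$ has no 2-separation $(G_1,G_2)$ with $V(G_1\cap G_2)=\{s,t\}$ such that $x,s,t,y$ occur on $xCy$ in this order, $sCt\subseteq G_2$, and $|G_2|\ge 3$. Define $\tau_G(xy)=2/3$ if $xCy$ is not good; $\tau_G(xy)=2/3$ if exactly one of $x,y$ is an edge of $C$ and $x$ and $y$ are incident; $\tau_G(xy)=1/3$ if exactly one of $x,y$ is an edge of $C$ and $|xCy|=2$; and $\tau_G(xy)=0$ otherwise (cases checked in this order). -}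

module Defs where

open import Data.Bool using (Bool; true; false; _∧_; _∨_; not; if_then_else_)
open import Data.Nat using (ℕ; zero; suc; _+_; _*_; _∸_; _≤_; _<_; _%_)
open import Data.Nat.DivMod using (_mod_)
open import Data.Fin using (Fin; toℕ; _≟_; _<?_)
import Data.Fin as Fin
open import Data.List using (List; []; _∷_; head; last)
open import Data.Bool.ListAction using (any)
open import Data.List.Relation.Unary.Linked using (Linked)
open import Data.List.Relation.Unary.Unique.Propositional using (Unique)
open import Data.Maybe using (just)
open import Data.Product using (Σ; ∃; _×_; _,_)
open import Data.Sum using (_⊎_)
open import Data.Integer using (ℤ; +_)
import Data.Integer as ℤ
open import Data.Rational using (ℚ; 0ℚ; _/_)
import Data.Rational as ℚ
open import Relation.Nullary using (¬_)
import Data.Empty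
import Data.Nat
open import Relation.Nullary.Decidable using (⌊_⌋)
open import Relation.Binary.PropositionalEquality using (_≡_)
open import Function using (_∘_)

count : ∀ {n} → (Fin n → Bool) → ℕ
count {zero}  f = 0
count {suc n} f = (if f Fin.zero then 1 else 0) + count (f ∘ Fin.suc)

sumF : ∀ {n} → (Fin n → ℕ) → ℕ
sumF {zero}  f = 0
sumF {suc n} f = f Fin.zero + sumF (f ∘ Fin.suc)

anyF : ∀ {n} → (Fin n → Bool) → Bool
anyF {zero}  f = false
anyF {suc n} f = f Fin.zero ∨ anyF (f ∘ Fin.suc)

eqF : ∀ {n} → Fin n → Fin n → Bool
eqF x y = ⌊ x ≟ y ⌋

ltF : ∀ {n} → Fin n → Fin n → Bool
ltF x y = ⌊ x <? y ⌋

iter : ∀ {A : Set} → (A → A) → ℕ → A → A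
iter f zero    a = a
iter f (suc i) a = f (iter f i a)

record Graph (n : ℕ) : Set where
  field
    adj  : Fin n → Fin n → Bool
    sym  : ∀ x y → adj x y ≡ adj y x
    irr  : ∀ x → adj x x ≡ false
open Graph public

edgeCount : ∀ {n} → Graph n → ℕ
edgeCount G = sumF (λ x → count (λ y → adj G x y ∧ ltF x y))

record Subgraph {n} (G : Graph n) : Set where
  field
    V     : Fin n → Bool
    E     : Fin n → Fin n → Bool
    Esym  : ∀ x y → E x y ≡ E y x
    Eadj  : ∀ x y → E x y ≡ true → adj G x y ≡ true
    Eend  : ∀ x y → E x y ≡ true → V x ≡ true
open Subgraph public

_⊑_ : ∀ {n} {G : Graph n} → Subgraph G → Subgraph G → Set
H ⊑ H' = (∀ x → V H x ≡ true → V H' x ≡ true)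
       × (∀ x y → E H x y ≡ true → E H' x y ≡ true)

record IsSeparation {n} (G : Graph n) (k : ℕ) (G1 G2 : Subgraph G) : Set where
  field
    unionV : ∀ x → V G1 x ∨ V G2 x ≡ true
    unionE : ∀ x y → adj G x y ≡ true → E G1 x y ∨ E G2 x y ≡ true
    disjE  : ∀ x y → E G1 x y ∧ E G2 x y ≡ false
    size   : count (λ x → V G1 x ∧ V G2 x) ≡ k
    notSub₁ : ¬ (G1 ⊑ G2)
    notSub₂ : ¬ (G2 ⊑ G1)

IsCut : ∀ {n} → Graph n → ℕ → (Fin n → Bool) → Set
IsCut G k S =
  count S ≡ k ×
  Σ (Subgraph G) λ G1 → Σ (Subgraph G) λ G2 →
    IsSeparation G k G1 G2 ×
    (∀ x → V G1 x ∧ V G2 x ≡ S x) ×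
    (∃ λ x → V G1 x ∧ not (V G2 x) ≡ true) ×
    (∃ λ x → V G2 x ∧ not (V G1 x) ≡ true)

reachK : ∀ {n} → Graph n → (Fin n → Bool) → Fin n → ℕ → Fin n → Bool
reachK G S x zero    y = eqF x y ∧ not (S x)
reachK G S x (suc i) y =
  reachK G S x i y ∨ (not (S y) ∧ anyF (λ z → reachK G S x i z ∧ adj G z y))

-- comp G S x y : y lies in the component of G - S containing x
-- (x, y ∉ S and y reachable from x by a walk avoiding S)
comp : ∀ {n} → Graph n → (Fin n → Bool) → Fin n → Fin n → Bool
comp {n} G S x = reachK G S x n

ConnectedMinus : ∀ {n} → Graph n → (Fin n → Bool) → Set
ConnectedMinus G S = ∀ y z → S y ≡ false → S z ≡ false → comp G S y z ≡ true

TwoConnected : ∀ {n} → Graph n → Set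
TwoConnected {n} G =
  3 ≤ n × ConnectedMinus G (λ _ → false) × (∀ x → ConnectedMinus G (eqF x))

-- The cycle C, given clockwise as c : Fin (suc k) → Fin n

nxt : ∀ {k} → Fin (suc k) → Fin (suc k)
nxt {k} i = suc (toℕ i) mod (suc k)

-- elements of V(C) ∪ E(C): vertex c i, or the edge c i c (nxt i)
data CElt (k : ℕ) : Set where
  vert : Fin (suc k) → CElt k
  edge : Fin (suc k) → CElt k

-- position on the clockwise cyclic sequence c0, e0, c1, e1, ...
pos : ∀ {k} → CElt k → ℕ
pos (vert i) = 2 * toℕ i
pos (edge i) = 2 * toℕ i + 1

dist : ∀ {k} → CElt k → CElt k → ℕ
dist {k} a b = (pos b + 2 * suc k ∸ pos a) % (2 * suc k)

isEdge : ∀ {k} → CElt k → Bool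
isEdge (vert _) = false
isEdge (edge _) = true

-- number of vertices of the path xCy
pathLen : ∀ {k} → CElt k → CElt k → ℕ
pathLen {k} x y = count (λ i → ⌊ dist x (vert {k} i) Data.Nat.≤? dist x y ⌋)

incident : ∀ {k} → CElt k → CElt k → Bool
incident (vert i) (edge j) = eqF i j ∨ eqF i (nxt j)
incident (edge j) (vert i) = eqF i j ∨ eqF i (nxt j)
incident _ _ = false

ExactlyOneEdge : ∀ {k} → CElt k → CElt k → Set
ExactlyOneEdge x y = (isEdge x ∧ not (isEdge y)) ∨ (isEdge y ∧ not (isEdge x)) ≡ true

module _ {n k : ℕ} (G : Graph n) (c : Fin (suc k) → Fin n) where

  -- the subpath sCt of C (s, t vertex indices) is contained in H
  SubpathIn : Subgraph G → Fin (suc k) → Fin (suc k) → Set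
  SubpathIn H s t =
    (∀ i → dist (vert s) (vert i) ≤ dist (vert s) (vert t) → V H (c i) ≡ true) ×
    (∀ j → dist (vert s) (edge j) < dist (vert s) (vert t) → E H (c j) (c (nxt j)) ≡ true)

  Good : CElt k → CElt k → Set
  Good x y =
    ∀ (G1 G2 : Subgraph G) (s t : Fin (suc k)) →
      IsSeparation G 2 G1 G2 →
      (∀ z → V G1 z ∧ V G2 z ≡ (eqF z (c s) ∨ eqF z (c t))) →
      dist x (vert s) < dist x (vert t) →
      dist x (vert t) ≤ dist x y →
      SubpathIn G2 s t →
      3 ≤ count (V G2) →
      Data.Empty.⊥

  data Tau (x y : CElt k) : ℚ → Set where
    notGood : ¬ Good x y → Tau x y (+ 2 / 3)
    oneIncident : Good x y → ExactlyOneEdge x y → incident x y ≡ true → Tau x y (+ 2 / 3)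
    oneLen2 : Good x y → ExactlyOneEdge x y → incident x y ≡ false →
              pathLen x y ≡ 2 → Tau x y (+ 1 / 3)
    otherwise : Good x y → ¬ (ExactlyOneEdge x y × incident x y ≡ true) →
                ¬ (ExactlyOneEdge x y × pathLen x y ≡ 2) → Tau x y 0ℚ

-- Plane embeddings as rotation systems

-- rot x : cyclic permutation of the neighbours of x
record Rotation {n} (G : Graph n) : Set where
  field
    rot    : Fin n → Fin n → Fin n
    rotNbr : ∀ x y → adj G x y ≡ true → adj G x (rot x y) ≡ true
    rotCyc : ∀ x y y' → adj G x y ≡ true → adj G x y' ≡ true →
             ∃ λ i → iter (rot x) i y ≡ y'
open Rotation public

Dart : ∀ {n} → Graph n → Set
Dart {n} G = Σ (Fin n × Fin n) λ { (x , y) → adj G x y ≡ true }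

-- face permutation on darts
faceStep : ∀ {n} {G : Graph n} → Rotation G → Fin n × Fin n → Fin n × Fin n
faceStep ρ (x , y) = (y , rot ρ y x)

HasFaces : ∀ {n} {G : Graph n} → Rotation G → ℕ → Set
HasFaces {n} {G} ρ F =
  Σ (Fin n × Fin n → Fin F) λ lab →
    (∀ (d d' : Dart G) →
      (lab (Data.Product.proj₁ d) ≡ lab (Data.Product.proj₁ d') →
         ∃ λ i → iter (faceStep ρ) i (Data.Product.proj₁ d) ≡ Data.Product.proj₁ d') ×
      ((∃ λ i → iter (faceStep ρ) i (Data.Product.proj₁ d) ≡ Data.Product.proj₁ d') →
         lab (Data.Product.proj₁ d) ≡ lab (Data.Product.proj₁ d'))) ×
    (∀ (f : Fin F) → Σ (Dart G) λ d → lab (Data.Product.proj₁ d) ≡ f)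

-- planar (genus 0, Euler's formula) rotation system
Planar : ∀ {n} {G : Graph n} → Rotation G → Set
Planar {n} {G} ρ = ∃ λ F → HasFaces ρ F × n + F ≡ edgeCount G + 2

record CircuitGraph {n k : ℕ} (G : Graph n) (c : Fin (suc k) → Fin n) : Set where
  field
    cycLen  : 3 ≤ suc k
    cycInj  : ∀ i j → c i ≡ c j → i ≡ j
    cycAdj  : ∀ i → adj G (c i) (c (nxt i)) ≡ true
    twoConn : TwoConnected G
    -- a plane embedding in which C, traversed as c0 c1 ..., is the outer face
    embedding : Σ (Rotation G) λ ρ → Planar ρ ×
                  (∀ i → faceStep ρ (c i , c (nxt i)) ≡ (c (nxt i) , c (nxt (nxt i))))
    circuit : ∀ T → IsCut G 2 T → ∀ x → T x ≡ false →
              ∃ λ i → T (c i) ≡ false × comp G T x (c i) ≡ true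

inList : ∀ {n} → List (Fin n) → Fin n → Bool
inList P z = any (eqF z) P

pathEdge : ∀ {n} → List (Fin n) → Fin n → Fin n → Bool
pathEdge []            a b = false
pathEdge (x ∷ [])      a b = false
pathEdge (x ∷ y ∷ P)   a b =
  (eqF x a ∧ eqF y b) ∨ (eqF x b ∧ eqF y a) ∨ pathEdge (y ∷ P) a b

IsPath : ∀ {n} → Graph n → List (Fin n) → Fin n → Fin n → Set
IsPath G P u v =
  Unique P × Linked (λ a b → adj G a b ≡ true) P × head P ≡ just u × last P ≡ just v

module _ {n : ℕ} (G : Graph n) (P : List (Fin n)) where

  -- attachments of the P-bridge of the component of G - V(P) containing x
  attach : Fin n → ℕ
  attach x = count (λ p → inList P p ∧ anyF (λ z → comp G (inList P) x z ∧ adj G z p))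

  -- number of vertices of that bridge
  bridgeSize : Fin n → ℕ
  bridgeSize x = count (comp G (inList P) x) + attach x

  -- x is the least vertex of its component of G - V(P)
  isRep : Fin n → Bool
  isRep x = not (inList P x) ∧ not (anyF (λ y → comp G (inList P) x y ∧ ltF y x))

  -- β_G(P): number of P-bridges with at least 3 vertices
  -- (bridges consisting of a single chord edge have 2 vertices and never count)
  β : ℕ
  β = count (λ x → isRep x ∧ ⌊ 3 Data.Nat.≤? bridgeSize x ⌋)

  -- P is a Tutte subgraph (chord bridges have 2 attachments, so only
  -- component bridges need checking)
  Tutte : Set
  Tutte = ∀ x → inList P x ≡ false → attach x ≤ 3

  CTutte : ∀ {k} → (Fin (suc k) → Fin n) → Set
  CTutte c = Tutte ×
    (∀ x → inList P x ≡ false →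
      (∃ λ j → comp G (inList P) x (c j) ∨ comp G (inList P) x (c (nxt j)) ≡ true) →
      attach x ≤ 2)

-- If e = uv, the path uv itself works. Were some component of G − {u, v} to miss C − {u, v},
-- then {u, v} would be a 2-cut violating the circuit-graph condition; and C − {u, v} is a path,
-- so G − {u, v} is connected and uv has at most one bridge. The edge uv alone is split off by a
-- 2-separation at {u, v}, so vCu is not good; as u and v are incident with e, all three τ are 2/3
-- and the bound is (n − 6)/3 + 2 = n/3 ≥ 1.
-- If n = 3, C is a triangle through every vertex, so the u–v path along C through e is spanning
-- and β = 0. When e ≠ uv, one of τ(ue), τ(ev) is 2/3 (incidence) and the other at least 1/3
-- (a segment with two vertices), which makes up for (3 − 6)/3 = −1.

module Submission where

open import Defs hiding (sym)
open import Data.Nat using (ℕ; zero; suc; _≤_; _<_; z≤n; s≤s; _+_; _*_; _∸_; _%_)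
import Data.Nat as ℕ
import Data.Nat.Properties as ℕP
open import Data.Nat.Tactic.RingSolver using (solve-∀)
open import Data.Nat.DivMod using (m<n⇒m%n≡m; n%n≡0; [m+n]%n≡m%n)
open import Data.Fin using (Fin; toℕ)
import Data.Fin as F
import Data.Fin.Properties as FP
open import Data.Fin.Properties using (all?)
open import Data.List using (List; []; _∷_)
open import Data.List.Relation.Unary.AllPairs using ([]; _∷_)
open import Data.List.Relation.Unary.All using ([]; _∷_)
open import Data.List.Relation.Unary.Linked using ([-]; _∷_)
open import Data.Bool using (Bool; true; false; _∧_; _∨_; not; if_then_else_)
open import Data.Bool.Properties using (∨-comm; ∧-comm; ∨-zeroʳ; ∧-identityʳ; ∨-identityʳ; not-injective; not-¬; ¬-not)
import Data.Bool as Bool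
open import Data.Product using (Σ; _×_; _,_; proj₁; proj₂; ∃)
open import Data.Sum using (_⊎_; inj₁; inj₂)
open import Data.Empty using (⊥-elim)
open import Relation.Nullary using (¬_; yes; no; contradiction)
open import Relation.Nullary.Decidable using (⌊_⌋; from-yes; _→-dec_; _×-dec_; _⊎-dec_)
open import Data.Integer using (+_)
import Data.Integer as ℤ
open import Data.Rational using (ℚ; _/_; 0ℚ)
import Data.Rational as ℚ
import Data.Rational.Properties as QP
open import Relation.Binary using (tri<; tri≈; tri>)
open import Relation.Binary.PropositionalEquality using (_≡_; _≢_; refl; sym; trans; cong; cong₂; subst; subst₂; _≗_)
open import Function using (_∘_)

∨-introˡ : ∀ {a b} → a ≡ true → a ∨ b ≡ true
∨-introˡ refl = refl

∨-introʳ : ∀ a {b} → b ≡ true → a ∨ b ≡ true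
∨-introʳ true  _    = refl
∨-introʳ false refl = refl

∨-cases : ∀ a {b} → a ∨ b ≡ true → a ≡ true ⊎ b ≡ true
∨-cases true  _ = inj₁ refl
∨-cases false h = inj₂ h

∧-intro : ∀ {a b} → a ≡ true → b ≡ true → a ∧ b ≡ true
∧-intro refl refl = refl

∧-split : ∀ a {b} → a ∧ b ≡ true → a ≡ true × b ≡ true
∧-split true h = refl , h

eqF-refl : ∀ {n} (x : Fin n) → eqF x x ≡ true
eqF-refl x with x F.≟ x
... | yes _  = refl
... | no x≢x = contradiction refl x≢x

eqF⇒≡ : ∀ {n} {x y : Fin n} → eqF x y ≡ true → x ≡ y
eqF⇒≡ {x = x} {y} h with x F.≟ y
... | yes x≡y = x≡y

≢⇒eqF-false : ∀ {n} {x y : Fin n} → x ≢ y → eqF x y ≡ false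
≢⇒eqF-false {x = x} {y} x≢y with x F.≟ y
... | yes x≡y = contradiction x≡y x≢y
... | no _    = refl

eqF-suc : ∀ {n} (x y : Fin n) → eqF (F.suc x) (F.suc y) ≡ eqF x y
eqF-suc x y with x F.≟ y
... | yes _ = refl
... | no _  = refl

ltF-intro : ∀ {n} {x y : Fin n} → x F.< y → ltF x y ≡ true
ltF-intro {x = x} {y} x<y with x F.<? y
... | yes _   = refl
... | no x≮y  = contradiction x<y x≮y

count-cong : ∀ {n} {f g : Fin n → Bool} → f ≗ g → count f ≡ count g
count-cong {zero}  _   = refl
count-cong {suc n} f≗g =
  cong₂ _+_ (cong (λ b → if b then 1 else 0) (f≗g F.zero)) (count-cong (f≗g ∘ F.suc))

count-mono : ∀ {n} (f g : Fin n → Bool) → (∀ x → f x ≡ true → g x ≡ true) → count f ≤ count g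
count-mono {zero}  f g f⊆g = z≤n
count-mono {suc n} f g f⊆g with f F.zero in f₀ | g F.zero in g₀
... | true  | true  = s≤s (count-mono (f ∘ F.suc) (g ∘ F.suc) (f⊆g ∘ F.suc))
... | true  | false = ⊥-elim (not-¬ (f⊆g F.zero f₀) g₀)
... | false | true  = ℕP.m≤n⇒m≤1+n (count-mono (f ∘ F.suc) (g ∘ F.suc) (f⊆g ∘ F.suc))
... | false | false = count-mono (f ∘ F.suc) (g ∘ F.suc) (f⊆g ∘ F.suc)

count-strict : ∀ {n} (f g : Fin n → Bool) → (∀ x → f x ≡ true → g x ≡ true) →
               ∀ y → g y ≡ true → f y ≡ false → suc (count f) ≤ count g
count-strict {suc n} f g f⊆g F.zero gy fy rewrite gy | fy =
  s≤s (count-mono (f ∘ F.suc) (g ∘ F.suc) (f⊆g ∘ F.suc))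
count-strict {suc n} f g f⊆g (F.suc y) gy fy with f F.zero in f₀ | g F.zero in g₀
... | true  | true  = s≤s (count-strict (f ∘ F.suc) (g ∘ F.suc) (f⊆g ∘ F.suc) y gy fy)
... | true  | false = ⊥-elim (not-¬ (f⊆g F.zero f₀) g₀)
... | false | true  = ℕP.m≤n⇒m≤1+n (count-strict (f ∘ F.suc) (g ∘ F.suc) (f⊆g ∘ F.suc) y gy fy)
... | false | false = count-strict (f ∘ F.suc) (g ∘ F.suc) (f⊆g ∘ F.suc) y gy fy

count-none : ∀ {n} (f : Fin n → Bool) → (∀ x → f x ≡ false) → count f ≡ 0
count-none {zero}  f _    = refl
count-none {suc n} f none rewrite none F.zero = count-none (f ∘ F.suc) (none ∘ F.suc)

count-all : ∀ n → count {n} (λ _ → true) ≡ n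
count-all zero    = refl
count-all (suc n) = cong suc (count-all n)

count≤size : ∀ {n} (f : Fin n → Bool) → count f ≤ n
count≤size {n} f = ℕP.≤-trans (count-mono f (λ _ → true) (λ _ _ → refl)) (ℕP.≤-reflexive (count-all n))

count≤1 : ∀ {n} (f : Fin n → Bool) → (∀ x y → f x ≡ true → f y ≡ true → x ≡ y) → count f ≤ 1
count≤1 {zero}  f unique = z≤n
count≤1 {suc n} f unique with f F.zero in f₀
... | true  = ℕP.≤-reflexive (cong suc (count-none (f ∘ F.suc) others))
  where
  others : ∀ x → f (F.suc x) ≡ false
  others x with f (F.suc x) in fx
  ... | true  with () ← unique F.zero (F.suc x) f₀ fx
  ... | false = refl
... | false = count≤1 (f ∘ F.suc) (λ x y fx fy → FP.suc-injective (unique (F.suc x) (F.suc y) fx fy))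

count-single : ∀ {n} (u : Fin n) → count (λ z → eqF z u) ≡ 1
count-single {suc n} F.zero    = cong suc (count-none {n} _ (λ _ → refl))
count-single {suc n} (F.suc u) = trans (count-cong (λ x → eqF-suc x u)) (count-single u)

count-pair : ∀ {n} (u v : Fin n) → u ≢ v → count (λ z → eqF z u ∨ eqF z v) ≡ 2
count-pair {suc n} F.zero    F.zero    u≢v = contradiction refl u≢v
count-pair {suc n} F.zero    (F.suc v) _   = cong suc (trans (count-cong (λ x → eqF-suc x v)) (count-single v))
count-pair {suc n} (F.suc u) F.zero    _   =
  cong suc (trans (count-cong (λ x → trans (∨-identityʳ _) (eqF-suc x u))) (count-single u))
count-pair {suc n} (F.suc u) (F.suc v) u≢v =
  trans (count-cong (λ x → cong₂ _∨_ (eqF-suc x u) (eqF-suc x v))) (count-pair u v (u≢v ∘ cong F.suc))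

count-pos : ∀ {n} (f : Fin n → Bool) y → f y ≡ true → 1 ≤ count f
count-pos {n} f y fy =
  subst (λ m → suc m ≤ count f) (count-none {n} _ (λ _ → refl)) (count-strict (λ _ → false) f (λ _ ()) y fy refl)

anyF-intro : ∀ {n} (f : Fin n → Bool) y → f y ≡ true → anyF f ≡ true
anyF-intro f F.zero    fy = ∨-introˡ fy
anyF-intro f (F.suc y) fy = ∨-introʳ (f F.zero) (anyF-intro (f ∘ F.suc) y fy)

anyF-witness : ∀ {n} (f : Fin n → Bool) → anyF f ≡ true → ∃ λ y → f y ≡ true
anyF-witness {suc n} f h with ∨-cases (f F.zero) h
... | inj₁ f₀ = F.zero , f₀
... | inj₂ fs with y , fy ← anyF-witness (f ∘ F.suc) fs = F.suc y , fy

module Reachability {n : ℕ} (G : Graph n) (S : Fin n → Bool) where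

  reach : Fin n → ℕ → Fin n → Bool
  reach = reachK G S

  reach-zero⇒≡ : ∀ x {y} → reach x 0 y ≡ true → x ≡ y × S x ≡ false
  reach-zero⇒≡ x {y} h with x≡y , x∉S ← ∧-split (eqF x y) h = eqF⇒≡ x≡y , not-injective x∉S

  reach-suc-cases : ∀ x i {y} → reach x (suc i) y ≡ true →
    reach x i y ≡ true ⊎ (S y ≡ false × ∃ λ z → reach x i z ≡ true × adj G z y ≡ true)
  reach-suc-cases x i {y} h with ∨-cases (reach x i y) h
  ... | inj₁ old = inj₁ old
  ... | inj₂ new with y∉S , nbr ← ∧-split (not (S y)) new
                 with z , zy ← anyF-witness _ nbr =
    inj₂ (not-injective y∉S , z , ∧-split (reach x i z) zy)

  reach-extend : ∀ x i {z y} → reach x i z ≡ true → adj G z y ≡ true → S y ≡ false → reach x (suc i) y ≡ true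
  reach-extend x i {z} {y} xz zy y∉S =
    ∨-introʳ (reach x i y) (∧-intro (cong not y∉S) (anyF-intro _ z (∧-intro xz zy)))

  reach⇒∉S : ∀ x i y → reach x i y ≡ true → S x ≡ false × S y ≡ false
  reach⇒∉S x zero y h with refl , x∉S ← reach-zero⇒≡ x h = x∉S , x∉S
  reach⇒∉S x (suc i) y h with reach-suc-cases x i h
  ... | inj₁ old                 = reach⇒∉S x i y old
  ... | inj₂ (y∉S , z , xz , _) = proj₁ (reach⇒∉S x i z xz) , y∉S

  reach-self : ∀ {x} → S x ≡ false → ∀ i → reach x i x ≡ true
  reach-self {x} x∉S zero    = ∧-intro (eqF-refl x) (cong not x∉S)
  reach-self {x} x∉S (suc i) = ∨-introˡ (reach-self x∉S i)

  Saturated : Fin n → ℕ → Set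
  Saturated x i = ∀ y → reach x (suc i) y ≡ true → reach x i y ≡ true

  saturated-suc : ∀ {x i} → Saturated x i → Saturated x (suc i)
  saturated-suc {x} {i} sat y h with reach-suc-cases x (suc i) h
  ... | inj₁ old                   = old
  ... | inj₂ (y∉S , z , xz , zy) = reach-extend x i (sat z xz) zy y∉S

  -- each unsaturated step adds a vertex, so saturation happens within n steps
  saturated-or-grows : ∀ {x} → S x ≡ false → ∀ i → Saturated x i ⊎ suc i ≤ count (reach x i)
  saturated-or-grows {x} x∉S zero = inj₂ (count-pos (reach x 0) x (reach-self x∉S 0))
  saturated-or-grows {x} x∉S (suc i) with saturated-or-grows x∉S i
  ... | inj₁ sat  = inj₁ (saturated-suc {x} {i} sat)
  ... | inj₂ grow with anyF (λ y → reach x (suc i) y ∧ not (reach x i y)) in new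
  ... | true with y , hy ← anyF-witness _ new with xy , ¬old ← ∧-split (reach x (suc i) y) hy =
    inj₂ (ℕP.≤-trans (s≤s grow) (count-strict (reach x i) (reach x (suc i)) (λ _ → ∨-introˡ) y xy (not-injective ¬old)))
  ... | false = inj₁ (saturated-suc {x} {i} sat)
    where
    sat : Saturated x i
    sat y h with reach x i y Bool.≟ true
    ... | yes old = old
    ... | no ¬old = ⊥-elim (not-¬ (anyF-intro _ y (∧-intro h (cong not (¬-not ¬old)))) new)

  saturated-at-size : ∀ {x} → S x ≡ false → Saturated x n
  saturated-at-size {x} x∉S with saturated-or-grows x∉S n
  ... | inj₁ sat  = sat
  ... | inj₂ grow = contradiction (count≤size (reach x n)) (ℕP.<⇒≱ grow)

  comp⇒∉S : ∀ {x y} → comp G S x y ≡ true → S x ≡ false × S y ≡ false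
  comp⇒∉S {x} {y} = reach⇒∉S x n y

  comp-refl : ∀ {x} → S x ≡ false → comp G S x x ≡ true
  comp-refl x∉S = reach-self x∉S n

  comp-extend : ∀ {x y z} → comp G S x y ≡ true → adj G y z ≡ true → S z ≡ false → comp G S x z ≡ true
  comp-extend {x} {y} {z} xy yz z∉S =
    saturated-at-size (proj₁ (comp⇒∉S xy)) z (reach-extend x n xy yz z∉S)

  comp-trans : ∀ {x y z} → comp G S x y ≡ true → comp G S y z ≡ true → comp G S x z ≡ true
  comp-trans {x} {y} xy = along n
    where
    along : ∀ i {z} → reach y i z ≡ true → comp G S x z ≡ true
    along zero    yz with refl , _ ← reach-zero⇒≡ y yz = xy
    along (suc i) yz with reach-suc-cases y i yz
    ... | inj₁ old                   = along i old
    ... | inj₂ (z∉S , w , yw , wz) = comp-extend (along i yw) wz z∉S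

  comp-sym : ∀ {x y} → comp G S x y ≡ true → comp G S y x ≡ true
  comp-sym {x} = along n
    where
    along : ∀ i {y} → reach x i y ≡ true → comp G S y x ≡ true
    along zero    xy with refl , x∉S ← reach-zero⇒≡ x xy = comp-refl x∉S
    along (suc i) xy with reach-suc-cases x i xy
    ... | inj₁ old                   = along i old
    ... | inj₂ (y∉S , w , xw , wy) =
      comp-trans (comp-extend (comp-refl y∉S) (trans (Graph.sym G _ _) wy) (proj₂ (reach⇒∉S x i w xw))) (along i xw)

module _ {n : ℕ} (G : Graph n) (S : Fin n → Bool) where
  open Reachability G S

  -- the component K of x together with S, against everything outside K
  separated⇒cut : ∀ {x w} → S x ≡ false → S w ≡ false → comp G S x w ≡ false → IsCut G (count S) S
  separated⇒cut {x} {w} x∉S w∉S x≁w =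
    refl , G₁ , G₂ , separation , inner ,
    (x , ∧-intro (∨-introˡ x∈K) (cong not (cong not x∈K))) ,
    (w , ∧-intro (cong not x≁w) (cong not (cong₂ _∨_ x≁w w∉S)))
    where
    K : Fin n → Bool
    K = comp G S x

    x∈K : K x ≡ true
    x∈K = comp-refl x∉S

    G₁ : Subgraph G
    G₁ = record
      { V    = λ z → K z ∨ S z
      ; E    = λ y z → adj G y z ∧ (K y ∨ K z)
      ; Esym = λ y z → cong₂ _∧_ (Graph.sym G y z) (∨-comm (K y) (K z))
      ; Eadj = λ y z → proj₁ ∘ ∧-split (adj G y z)
      ; Eend = end
      }
      where
      end : ∀ y z → adj G y z ∧ (K y ∨ K z) ≡ true → K y ∨ S y ≡ true
      end y z h with yz , yK∨zK ← ∧-split (adj G y z) h with ∨-cases (K y) yK∨zK | S y in Sy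
      ... | inj₁ y∈K | _     = ∨-introˡ y∈K
      ... | inj₂ _   | true  = ∨-introʳ (K y) refl
      ... | inj₂ z∈K | false = ∨-introˡ (comp-extend z∈K (trans (Graph.sym G z y) yz) Sy)

    G₂ : Subgraph G
    G₂ = record
      { V    = λ z → not (K z)
      ; E    = λ y z → adj G y z ∧ (not (K y) ∧ not (K z))
      ; Esym = λ y z → cong₂ _∧_ (Graph.sym G y z) (∧-comm (not (K y)) (not (K z)))
      ; Eadj = λ y z → proj₁ ∘ ∧-split (adj G y z)
      ; Eend = λ y z h → proj₁ (∧-split (not (K y)) (proj₂ (∧-split (adj G y z) h)))
      }

    inner : ∀ z → (K z ∨ S z) ∧ not (K z) ≡ S z
    inner z with K z in z∈K
    ... | true  = sym (proj₂ (comp⇒∉S z∈K))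
    ... | false = ∧-identityʳ (S z)

    separation : IsSeparation G (count S) G₁ G₂
    separation = record
      { unionV  = λ z → covers (K z) (S z)
      ; unionE  = λ y z yz → subst (λ e → (e ∧ (K y ∨ K z)) ∨ (e ∧ (not (K y) ∧ not (K z))) ≡ true)
                                    (sym yz) (splits (K y) (K z))
      ; disjE   = λ y z → disjoint (adj G y z) (K y) (K z)
      ; size    = count-cong inner
      ; notSub₁ = λ (V₁⊆V₂ , _) → not-¬ (V₁⊆V₂ x (∨-introˡ x∈K)) (cong not x∈K)
      ; notSub₂ = λ (V₂⊆V₁ , _) → not-¬ (V₂⊆V₁ w (cong not x≁w)) (cong₂ _∨_ x≁w w∉S)
      }
      where
      covers : ∀ a b → (a ∨ b) ∨ not a ≡ true
      covers true  b = refl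
      covers false b = ∨-zeroʳ b
      splits : ∀ a b → (a ∨ b) ∨ (not a ∧ not b) ≡ true
      splits true  b     = refl
      splits false true  = refl
      splits false false = refl
      disjoint : ∀ e a b → (e ∧ (a ∨ b)) ∧ (e ∧ (not a ∧ not b)) ≡ false
      disjoint false a     b     = refl
      disjoint true  true  b     = refl
      disjoint true  false true  = refl
      disjoint true  false false = refl

module _ {n : ℕ} (G : Graph n) {u v : Fin n} (uv : adj G u v ≡ true) where

  isEdgeUV : Fin n → Fin n → Bool
  isEdgeUV y z = (eqF y u ∧ eqF z v) ∨ (eqF y v ∧ eqF z u)

  isEdgeUV-sym : ∀ y z → isEdgeUV y z ≡ isEdgeUV z y
  isEdgeUV-sym y z = trans (∨-comm (eqF y u ∧ eqF z v) _) (cong₂ _∨_ (∧-comm (eqF y v) _) (∧-comm (eqF y u) _))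

  isEdgeUV⇒ : ∀ y z → isEdgeUV y z ≡ true → (y ≡ u × z ≡ v) ⊎ (y ≡ v × z ≡ u)
  isEdgeUV⇒ y z h with ∨-cases (eqF y u ∧ eqF z v) h
  ... | inj₁ yu∧zv with yu , zv ← ∧-split (eqF y u) yu∧zv = inj₁ (eqF⇒≡ yu , eqF⇒≡ zv)
  ... | inj₂ yv∧zu with yv , zu ← ∧-split (eqF y v) yv∧zu = inj₂ (eqF⇒≡ yv , eqF⇒≡ zu)

  single-edge : Subgraph G
  single-edge = record
    { V    = λ z → eqF z u ∨ eqF z v
    ; E    = isEdgeUV
    ; Esym = isEdgeUV-sym
    ; Eadj = λ y z h → adjacent (isEdgeUV⇒ y z h)
    ; Eend = λ y z h → end (isEdgeUV⇒ y z h)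
    }
    where
    adjacent : ∀ {y z} → (y ≡ u × z ≡ v) ⊎ (y ≡ v × z ≡ u) → adj G y z ≡ true
    adjacent (inj₁ (refl , refl)) = uv
    adjacent (inj₂ (refl , refl)) = trans (Graph.sym G v u) uv
    end : ∀ {y z} → (y ≡ u × z ≡ v) ⊎ (y ≡ v × z ≡ u) → eqF y u ∨ eqF y v ≡ true
    end (inj₁ (refl , _)) = ∨-introˡ (eqF-refl u)
    end (inj₂ (refl , _)) = ∨-introʳ (eqF v u) (eqF-refl v)

  delete-edge : Subgraph G
  delete-edge = record
    { V    = λ _ → true
    ; E    = λ y z → adj G y z ∧ not (isEdgeUV y z)
    ; Esym = λ y z → cong₂ _∧_ (Graph.sym G y z) (cong not (isEdgeUV-sym y z))
    ; Eadj = λ y z → proj₁ ∘ ∧-split (adj G y z)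
    ; Eend = λ _ _ _ → refl
    }

  u≢v : u ≢ v
  u≢v refl = not-¬ uv (irr G u)

  edge-separation : ∀ {w} → w ≢ u → w ≢ v → IsSeparation G 2 single-edge delete-edge
  edge-separation {w} w≢u w≢v = record
    { unionV  = λ z → ∨-zeroʳ (eqF z u ∨ eqF z v)
    ; unionE  = λ y z yz → subst (λ e → isEdgeUV y z ∨ (e ∧ not (isEdgeUV y z)) ≡ true) (sym yz) (excluded (isEdgeUV y z))
    ; disjE   = λ y z → disjoint (isEdgeUV y z) (adj G y z)
    ; size    = trans (count-cong (λ z → ∧-identityʳ (eqF z u ∨ eqF z v))) (count-pair u v u≢v)
    ; notSub₁ = λ (_ , E₁⊆E₂) → not-¬ (proj₂ (∧-split (adj G u v) (E₁⊆E₂ u v uv∈E₁))) (cong not uv∈E₁)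
    ; notSub₂ = λ (V₂⊆V₁ , _) → not-¬ (V₂⊆V₁ w refl) (cong₂ _∨_ (≢⇒eqF-false w≢u) (≢⇒eqF-false w≢v))
    }
    where
    uv∈E₁ : isEdgeUV u v ≡ true
    uv∈E₁ = ∨-introˡ (∧-intro (eqF-refl u) (eqF-refl v))
    excluded : ∀ a → a ∨ (true ∧ not a) ≡ true
    excluded true  = refl
    excluded false = refl
    disjoint : ∀ a e → a ∧ (e ∧ not a) ≡ false
    disjoint true  true  = refl
    disjoint true  false = refl
    disjoint false e     = refl

module _ {k : ℕ} where

  nxt-cases : ∀ (x : Fin (suc k)) →
    (toℕ x < k × toℕ (nxt x) ≡ suc (toℕ x)) ⊎ (toℕ x ≡ k × toℕ (nxt x) ≡ 0)
  nxt-cases x with ℕP.m≤n⇒m<n∨m≡n (FP.toℕ≤pred[n] x)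
  ... | inj₁ x<k = inj₁ (x<k , trans (FP.toℕ-fromℕ< _) (m<n⇒m%n≡m (s≤s x<k)))
  ... | inj₂ x≡k = inj₂ (x≡k , trans (FP.toℕ-fromℕ< _) (trans (cong (λ m → suc m % suc k) x≡k) (n%n≡0 (suc k))))

  nxt-walk : (J : Fin (suc k) → Set) → (∀ m → J m → J (nxt m)) →
    ∀ {x} → J x → ∀ d → toℕ x + d ≤ k → Σ (Fin (suc k)) λ m → toℕ m ≡ toℕ x + d × J m
  nxt-walk J step {x} Jx zero    _ = x , sym (ℕP.+-identityʳ _) , Jx
  nxt-walk J step {x} Jx (suc d) x+d<k
    with m , m≡x+d , Jm ← nxt-walk J step Jx d (ℕP.≤-trans (ℕP.+-monoʳ-≤ (toℕ x) (ℕP.n≤1+n d)) x+d<k)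
    with nxt-cases m
  ... | inj₁ (_ , nxt-m) = nxt m , trans nxt-m (trans (cong suc m≡x+d) (sym (ℕP.+-suc (toℕ x) d))) , step m Jm
  ... | inj₂ (m≡k , _)   =
    contradiction (subst (_≤ k) (trans (ℕP.+-suc (toℕ x) d) (cong suc (trans (sym m≡x+d) m≡k))) x+d<k) (ℕP.n≮n k)

  nxt-induction : (J : Fin (suc k) → Set) → (∀ m → J m → J (nxt m)) → ∀ {x} → J x → ∀ p → J p
  nxt-induction J step {x} Jx p
    with last , last≡k , Jlast ← nxt-walk J step Jx (k ∸ toℕ x) (ℕP.≤-reflexive (ℕP.m+[n∸m]≡n (FP.toℕ≤pred[n] x)))
    with nxt-cases last
  ... | inj₁ (last<k , _) = contradiction (subst (_< k) (trans last≡k (ℕP.m+[n∸m]≡n (FP.toℕ≤pred[n] x))) last<k) (ℕP.n≮n k)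
  ... | inj₂ (_ , first≡0)
    with q , q≡p , Jq ← nxt-walk J step (step last Jlast) (toℕ p) (subst (λ i → i + toℕ p ≤ k) (sym first≡0) (FP.toℕ≤pred[n] p)) =
    subst J (FP.toℕ-injective (trans q≡p (cong (_+ toℕ p) first≡0))) Jq

  nxt≢ : 1 ≤ k → ∀ (x : Fin (suc k)) → nxt x ≢ x
  nxt≢ 1≤k x nxt≡x with nxt-cases x
  ... | inj₁ (_ , nxt-x)   = ℕP.<⇒≢ (ℕP.n<1+n (toℕ x)) (trans (sym (cong toℕ nxt≡x)) nxt-x)
  ... | inj₂ (x≡k , nxt-x) = ℕP.<⇒≢ 1≤k (trans (sym nxt-x) (trans (cong toℕ nxt≡x) x≡k))

  nxt²≢ : 2 ≤ k → ∀ (x : Fin (suc k)) → nxt (nxt x) ≢ x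
  nxt²≢ 2≤k x nxt²≡x with nxt-cases x | nxt-cases (nxt x) | cong toℕ nxt²≡x
  ... | inj₁ (_ , nxt-x) | inj₁ (_ , nxt²-x) | eq =
    ℕP.<⇒≢ (ℕP.m<n⇒m<1+n (ℕP.n<1+n (toℕ x))) (sym (trans (sym (trans nxt²-x (cong suc nxt-x))) eq))
  ... | inj₁ (_ , nxt-x) | inj₂ (nxt-x≡k , nxt²-x) | eq =
    ℕP.<⇒≢ 2≤k (trans (cong suc (sym (trans (sym eq) nxt²-x))) (trans (sym nxt-x) nxt-x≡k))
  ... | inj₂ (x≡k , nxt-x) | inj₁ (_ , nxt²-x) | eq =
    ℕP.<⇒≢ 2≤k (trans (sym (trans nxt²-x (cong suc nxt-x))) (trans eq x≡k))
  ... | inj₂ (_ , nxt-x) | inj₂ (nxt-x≡k , _) | _ =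
    ℕP.<⇒≢ (ℕP.≤-trans (s≤s z≤n) 2≤k) (trans (sym nxt-x) nxt-x≡k)

  dist-self : ∀ (x : CElt k) → dist x x ≡ 0
  dist-self x = trans (cong (_% (2 * suc k)) (ℕP.m+n∸m≡n (pos x) (2 * suc k))) (n%n≡0 (2 * suc k))

  2k+r<2[1+k] : ∀ {r} → r ≤ 1 → 2 * k + r < 2 * suc k
  2k+r<2[1+k] {r} r≤1 =
    subst (2 * k + r <_) (trans (ℕP.+-comm (2 * k) 2) (sym (ℕP.*-suc 2 k))) (ℕP.+-monoʳ-< (2 * k) (s≤s r≤1))

  -- dist (vert (nxt a)) x unfolded, for x = vert a (r = 0) and x = edge a (r = 1)
  dist-from-nxt : ∀ (a : Fin (suc k)) r → r ≤ 1 →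
    (2 * toℕ a + r + 2 * suc k ∸ 2 * toℕ (nxt a)) % (2 * suc k) ≡ 2 * k + r
  dist-from-nxt a r r≤1 with nxt-cases a
  ... | inj₁ (_ , nxt-a) rewrite nxt-a =
    trans (cong (_% (2 * suc k)) (trans (cong (_∸ 2 * suc (toℕ a)) (shift (toℕ a) r k)) (ℕP.m+n∸m≡n (2 * suc (toℕ a)) _)))
          (m<n⇒m%n≡m (2k+r<2[1+k] r≤1))
    where
    shift : ∀ t r k → 2 * t + r + 2 * suc k ≡ 2 * suc t + (2 * k + r)
    shift = solve-∀
  ... | inj₂ (a≡k , nxt-a) rewrite nxt-a | a≡k =
    trans ([m+n]%n≡m%n (2 * k + r) (2 * suc k)) (m<n⇒m%n≡m (2k+r<2[1+k] r≤1))

  dist-nxt-vert : ∀ (a : Fin (suc k)) → dist (vert (nxt a)) (vert a) ≡ 2 * k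
  dist-nxt-vert a =
    trans (cong (λ p → (p + 2 * suc k ∸ 2 * toℕ (nxt a)) % (2 * suc k)) (sym (ℕP.+-identityʳ (2 * toℕ a))))
          (trans (dist-from-nxt a 0 z≤n) (ℕP.+-identityʳ (2 * k)))

  dist-nxt-edge : ∀ (a : Fin (suc k)) → dist (vert (nxt a)) (edge a) ≡ 2 * k + 1
  dist-nxt-edge a = dist-from-nxt a 1 (s≤s z≤n)

  dist-nxt-vert<dist-nxt-edge : ∀ (a : Fin (suc k)) → dist (vert (nxt a)) (vert a) < dist (vert (nxt a)) (edge a)
  dist-nxt-vert<dist-nxt-edge a = subst₂ _<_ (sym (dist-nxt-vert a)) (sym (dist-nxt-edge a)) (ℕP.m<m+n (2 * k) (s≤s z≤n))

⅓ ⅔ : ℚ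
⅓ = + 1 / 3
⅔ = + 2 / 3

module _ {n k : ℕ} {G : Graph n} {c : Fin (suc k) → Fin n} {x y : CElt k} {t : ℚ} where

  τ-nonneg : Tau G c x y t → 0ℚ ℚ.≤ t
  τ-nonneg (notGood _)         = from-yes (0ℚ ℚ.≤? ⅔)
  τ-nonneg (oneIncident _ _ _) = from-yes (0ℚ ℚ.≤? ⅔)
  τ-nonneg (oneLen2 _ _ _ _)   = from-yes (0ℚ ℚ.≤? ⅓)
  τ-nonneg (otherwise _ _ _)   = QP.≤-refl

  τ-notGood : ¬ Good G c x y → Tau G c x y t → t ≡ ⅔
  τ-notGood _  (notGood _)         = refl
  τ-notGood ¬g (oneIncident g _ _) = contradiction g ¬g
  τ-notGood ¬g (oneLen2 g _ _ _)   = contradiction g ¬g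
  τ-notGood ¬g (otherwise g _ _)   = contradiction g ¬g

  τ-incident : ExactlyOneEdge x y → incident x y ≡ true → Tau G c x y t → t ≡ ⅔
  τ-incident _   _   (notGood _)         = refl
  τ-incident _   _   (oneIncident _ _ _) = refl
  τ-incident _   inc (oneLen2 _ _ ¬inc _) = ⊥-elim (not-¬ inc ¬inc)
  τ-incident one inc (otherwise _ ¬one _) = contradiction (one , inc) ¬one

  τ-pathLen2 : ExactlyOneEdge x y → incident x y ≡ false → pathLen x y ≡ 2 → Tau G c x y t → ⅓ ℚ.≤ t
  τ-pathLen2 _   _    _   (notGood _)          = from-yes (⅓ ℚ.≤? ⅔)
  τ-pathLen2 _   ¬inc _   (oneIncident _ _ inc) = ⊥-elim (not-¬ inc ¬inc)
  τ-pathLen2 _   _    _   (oneLen2 _ _ _ _)    = QP.≤-refl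
  τ-pathLen2 one _    len (otherwise _ _ ¬len) = contradiction (one , len) ¬len

excess : ℕ → ℚ
excess n = (+ n ℤ.- + 6) / 3

tutteBound : ℕ → ℚ → ℚ → ℚ → ℚ
tutteBound n t₁ t₂ t₃ = excess n ℚ.+ t₁ ℚ.+ t₂ ℚ.+ t₃

tutteBound-mono : ∀ m n {t₁ t₂ t₃ s₁ s₂ s₃} → excess m ℚ.≤ excess n → t₁ ℚ.≤ s₁ → t₂ ℚ.≤ s₂ → t₃ ℚ.≤ s₃ →
  tutteBound m t₁ t₂ t₃ ℚ.≤ tutteBound n s₁ s₂ s₃
tutteBound-mono m n m≤n t₁≤s₁ t₂≤s₂ t₃≤s₃ = QP.+-mono-≤ (QP.+-mono-≤ (QP.+-mono-≤ m≤n t₁≤s₁) t₂≤s₂) t₃≤s₃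

-- (n − 6)/3 + 2 = n/3; for n = 6 + m the excess is + m / 3 up to computation
one≤tutteBound-⅔ : ∀ n → 3 ≤ n → + 1 / 1 ℚ.≤ tutteBound n ⅔ ⅔ ⅔
one≤tutteBound-⅔ 1 (s≤s ())
one≤tutteBound-⅔ 2 (s≤s (s≤s ()))
one≤tutteBound-⅔ 3 _ = from-yes (+ 1 / 1 ℚ.≤? tutteBound 3 ⅔ ⅔ ⅔)
one≤tutteBound-⅔ 4 _ = from-yes (+ 1 / 1 ℚ.≤? tutteBound 4 ⅔ ⅔ ⅔)
one≤tutteBound-⅔ 5 _ = from-yes (+ 1 / 1 ℚ.≤? tutteBound 5 ⅔ ⅔ ⅔)
one≤tutteBound-⅔ (suc (suc (suc (suc (suc (suc m)))))) _ =
  QP.≤-trans (from-yes (+ 1 / 1 ℚ.≤? tutteBound 6 ⅔ ⅔ ⅔))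
    (tutteBound-mono 6 (6 + m) (QP.nonNegative⁻¹ (+ m / 3) {{QP.normalize-nonNeg m 3}}) QP.≤-refl QP.≤-refl QP.≤-refl)

circuit-reaches-cycle : ∀ {n k} {G : Graph n} {c : Fin (suc k) → Fin n} → CircuitGraph G c →
  ∀ {T r} → count T ≡ 2 → T (c r) ≡ false →
  ∀ x → T x ≡ false → ∃ λ m → T (c m) ≡ false × comp G T x (c m) ≡ true
circuit-reaches-cycle {G = G} {c} CG {T} {r} |T|≡2 r∉T x x∉T with comp G T x (c r) in x~r
... | true  = r , r∉T , x~r
... | false = CircuitGraph.circuit CG T (subst (λ m → IsCut G m T) |T|≡2 (separated⇒cut G T x∉T r∉T x~r)) x x∉T

connected⇒β≤1 : ∀ {n} (G : Graph n) (P : List (Fin n)) →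
  (∀ x y → inList P x ≡ false → inList P y ≡ false → comp G (inList P) x y ≡ true) → β G P ≤ 1
connected⇒β≤1 G P connected =
  ℕP.≤-trans (count-mono _ (isRep G P) (λ x → proj₁ ∘ ∧-split (isRep G P x))) (count≤1 (isRep G P) unique)
  where
  unique : ∀ x y → isRep G P x ≡ true → isRep G P y ≡ true → x ≡ y
  unique x y x-rep y-rep
    with x∉P , x-least ← ∧-split (not (inList P x)) x-rep
       | y∉P , y-least ← ∧-split (not (inList P y)) y-rep
    with FP.<-cmp x y
  ... | tri≈ _ x≡y _ = x≡y
  ... | tri< x<y _ _ = ⊥-elim (not-¬ (anyF-intro _ x (∧-intro (connected y x (not-injective y∉P) (not-injective x∉P)) (ltF-intro x<y)))
                                   (not-injective y-least))
  ... | tri> _ _ y<x = ⊥-elim (not-¬ (anyF-intro _ y (∧-intro (connected x y (not-injective x∉P) (not-injective y∉P)) (ltF-intro y<x)))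
                                   (not-injective x-least))

attach≤count : ∀ {n} (G : Graph n) (P : List (Fin n)) x → attach G P x ≤ count (inList P)
attach≤count G P x = count-mono _ (inList P) (λ p → proj₁ ∘ ∧-split (inList P p))

BoundedCTuttePath : ∀ {n k} → Graph n → (Fin (suc k) → Fin n) → Fin n → Fin n → Fin (suc k) → ℚ → Set
BoundedCTuttePath {n} G c u v j bound =
  Σ (List (Fin n)) λ P →
    IsPath G P u v × CTutte G P c × pathEdge P (c j) (c (nxt j)) ≡ true × (+ β G P / 1) ℚ.≤ bound

module CycleEdgePath {n k : ℕ} {G : Graph n} {c : Fin (suc k) → Fin n} (CG : CircuitGraph G c) (a : Fin (suc k)) where
  open CircuitGraph CG

  2≤k : 2 ≤ k
  2≤k = ℕP.≤-pred cycLen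

  1≤k : 1 ≤ k
  1≤k = ℕP.≤-trans (s≤s z≤n) 2≤k

  r : Fin (suc k)
  r = nxt (nxt a)

  u v w : Fin n
  u = c a
  v = c (nxt a)
  w = c r

  uv : adj G u v ≡ true
  uv = cycAdj a

  w≢u : w ≢ u
  w≢u = nxt²≢ 2≤k a ∘ cycInj r a

  w≢v : w ≢ v
  w≢v = nxt≢ 1≤k (nxt a) ∘ cycInj r (nxt a)

  P : List (Fin n)
  P = u ∷ v ∷ []

  onP : Fin n → Bool
  onP = inList P

  onP-w : onP w ≡ false
  onP-w = cong₂ _∨_ (≢⇒eqF-false w≢u) (cong₂ _∨_ (≢⇒eqF-false w≢v) refl)

  onP⇒ : ∀ {z} → onP z ≡ true → z ≡ u ⊎ z ≡ v
  onP⇒ {z} h with ∨-cases (eqF z u) h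
  ... | inj₁ z≡u = inj₁ (eqF⇒≡ z≡u)
  ... | inj₂ z≡v = inj₂ (eqF⇒≡ (trans (sym (∨-identityʳ (eqF z v))) z≡v))

  |P|≡2 : count onP ≡ 2
  |P|≡2 = trans (count-cong (λ z → cong (eqF z u ∨_) (∨-identityʳ (eqF z v)))) (count-pair u v (u≢v G uv))

  open Reachability G onP

  -- C − {u, v} is the path from w around to the predecessor of u
  ReachedFromW : Fin (suc k) → Set
  ReachedFromW m = comp G onP w (c m) ≡ true ⊎ (m ≡ a ⊎ m ≡ nxt a)

  reachedFromW-nxt : ∀ m → ReachedFromW m → ReachedFromW (nxt m)
  reachedFromW-nxt m (inj₁ w~m) with onP (c (nxt m)) in onP-m′
  ... | false = inj₁ (comp-extend w~m (cycAdj m) onP-m′)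
  ... | true  with onP⇒ onP-m′
  ...   | inj₁ m′≡u = inj₂ (inj₁ (cycInj _ _ m′≡u))
  ...   | inj₂ m′≡v = inj₂ (inj₂ (cycInj _ _ m′≡v))
  reachedFromW-nxt m (inj₂ (inj₁ refl)) = inj₂ (inj₂ refl)
  reachedFromW-nxt m (inj₂ (inj₂ refl)) = inj₁ (comp-refl onP-w)

  cycle-connected : ∀ m → onP (c m) ≡ false → comp G onP w (c m) ≡ true
  cycle-connected m m∉P with nxt-induction ReachedFromW reachedFromW-nxt (inj₁ (comp-refl onP-w)) m
  ... | inj₁ w~m         = w~m
  ... | inj₂ (inj₁ refl) = ⊥-elim (not-¬ (∨-introˡ (eqF-refl u)) m∉P)
  ... | inj₂ (inj₂ refl) = ⊥-elim (not-¬ (∨-introʳ (eqF v u) (∨-introˡ (eqF-refl v))) m∉P)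

  G-P-connected : ∀ x y → onP x ≡ false → onP y ≡ false → comp G onP x y ≡ true
  G-P-connected x y x∉P y∉P
    with mx , mx∉P , x~mx ← circuit-reaches-cycle CG |P|≡2 onP-w x x∉P
       | my , my∉P , y~my ← circuit-reaches-cycle CG |P|≡2 onP-w y y∉P =
    comp-trans (comp-trans x~mx (comp-sym (cycle-connected mx mx∉P)))
               (comp-trans (cycle-connected my my∉P) (comp-sym y~my))

  vCu-not-good : ¬ Good G c (vert (nxt a)) (vert a)
  vCu-not-good good =
    good (single-edge G uv) (delete-edge G uv) (nxt a) a (edge-separation G uv w≢u w≢v)
      (λ z → trans (∧-identityʳ _) (∨-comm (eqF z u) (eqF z v)))
      (subst₂ _<_ (sym (dist-self (vert (nxt a)))) (sym (dist-nxt-vert a)) (ℕP.≤-trans 1≤k (ℕP.m≤m+n k _)))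
      ℕP.≤-refl
      ((λ _ _ → refl) , λ j j<a → ∧-intro (cycAdj j) (cong not (not-uv j j<a)))
      (subst (3 ≤_) (sym (count-all n)) (proj₁ twoConn))
    where
    not-uv : ∀ j → dist (vert (nxt a)) (edge j) < dist (vert (nxt a)) (vert a) → isEdgeUV G uv (c j) (c (nxt j)) ≡ false
    not-uv j j<a with isEdgeUV G uv (c j) (c (nxt j)) in e
    ... | false = refl
    ... | true with isEdgeUV⇒ G uv _ _ e
    ...   | inj₁ (j≡u , _) with refl ← cycInj j a j≡u = contradiction j<a (ℕP.<-asym (dist-nxt-vert<dist-nxt-edge a))
    ...   | inj₂ (j≡v , j′≡u) with refl ← cycInj j (nxt a) j≡v = contradiction (cycInj _ a j′≡u) (nxt²≢ 2≤k a)

  β-P≤1 : β G P ≤ 1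
  β-P≤1 = connected⇒β≤1 G P G-P-connected

  attach-P≤2 : ∀ x → attach G P x ≤ 2
  attach-P≤2 x = subst (attach G P x ≤_) |P|≡2 (attach≤count G P x)

  tuttePath : ∀ {t₁ t₂ t₃} →
    Tau G c (vert (nxt a)) (vert a) t₁ → Tau G c (vert a) (edge a) t₂ → Tau G c (edge a) (vert (nxt a)) t₃ →
    BoundedCTuttePath G c u v a (tutteBound n t₁ t₂ t₃)
  tuttePath τ₁ τ₂ τ₃ =
    P ,
    (((u≢v G uv ∷ []) ∷ [] ∷ []) , (uv ∷ [-]) , refl , refl) ,
    ((λ x _ → ℕP.m≤n⇒m≤1+n (attach-P≤2 x)) , (λ x _ _ → attach-P≤2 x)) ,
    ∨-introˡ (∧-intro (eqF-refl u) (eqF-refl v)) ,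
    QP.≤-trans (β≤1⇒ β-P≤1)
      (all-⅔ (τ-notGood vCu-not-good τ₁)
             (τ-incident refl (∨-introˡ (eqF-refl a)) τ₂)
             (τ-incident refl (∨-introʳ (eqF (nxt a) a) (eqF-refl (nxt a))) τ₃))
    where
    β≤1⇒ : ∀ {b} → b ≤ 1 → + b / 1 ℚ.≤ + 1 / 1
    β≤1⇒ z≤n       = from-yes (+ 0 / 1 ℚ.≤? + 1 / 1)
    β≤1⇒ (s≤s z≤n) = QP.≤-refl
    all-⅔ : ∀ {t₁ t₂ t₃} → t₁ ≡ ⅔ → t₂ ≡ ⅔ → t₃ ≡ ⅔ → + 1 / 1 ℚ.≤ tutteBound n t₁ t₂ t₃
    all-⅔ refl refl refl = one≤tutteBound-⅔ n (proj₁ twoConn)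

spanning⇒β≡0 : ∀ {n} (G : Graph n) (P : List (Fin n)) → (∀ x → inList P x ≡ true) → β G P ≡ 0
spanning⇒β≡0 G P spanning = count-none _ no-rep
  where
  no-rep : ∀ x → isRep G P x ∧ ⌊ 3 ℕ.≤? bridgeSize G P x ⌋ ≡ false
  no-rep x rewrite spanning x = refl

spanning⇒CTutte : ∀ {n k} (G : Graph n) (c : Fin (suc k) → Fin n) (P : List (Fin n)) →
  (∀ x → inList P x ≡ true) → CTutte G P c
spanning⇒CTutte G c P spanning =
  (λ x x∉P → ⊥-elim (not-¬ (spanning x) x∉P)) , (λ x x∉P _ → ⊥-elim (not-¬ (spanning x) x∉P))

injective⇒surjective : ∀ {m} (f : Fin m → Fin m) → (∀ i j → f i ≡ f j → i ≡ j) → ∀ y → ∃ λ i → f i ≡ y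
injective⇒surjective {m} f f-inj y with FP.any? (λ i → f i FP.≟ y)
... | yes hit = hit
... | no miss = contradiction (FP.injective⇒≤ (λ {i} {j} → g-inj i j)) ℕP.1+n≰n
  where
  g : Fin (suc m) → Fin m
  g F.zero    = y
  g (F.suc i) = f i
  g-inj : ∀ i j → g i ≡ g j → i ≡ j
  g-inj F.zero    F.zero    _ = refl
  g-inj F.zero    (F.suc j) e = contradiction (j , sym e) miss
  g-inj (F.suc i) F.zero    e = contradiction (i , e) miss
  g-inj (F.suc i) (F.suc j) e = cong F.suc (f-inj i j e)

circuit-on-3-vertices : ∀ {k} {G : Graph 3} {c : Fin (suc k) → Fin 3} → CircuitGraph G c → k ≡ 2
circuit-on-3-vertices CG =
  ℕP.suc-injective (ℕP.≤-antisym (FP.injective⇒≤ (λ {i} {j} → CircuitGraph.cycInj CG i j)) (CircuitGraph.cycLen CG))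

TriangleOrder : Fin 3 → Fin 3 → Fin 3 → Set
TriangleOrder i j l = (j ≡ i × l ≡ nxt i) ⊎ (j ≡ i × l ≡ nxt (nxt i)) ⊎ (j ≡ nxt i × l ≡ nxt (nxt i))

triangle-order : ∀ i j l → dist (vert i) (edge j) < dist (vert i) (vert l) → TriangleOrder i j l
triangle-order = from-yes (all? λ (i : Fin 3) → all? λ (j : Fin 3) → all? λ (l : Fin 3) →
  (dist (vert i) (edge j) ℕ.<? dist (vert i) (vert l)) →-dec
    (((j FP.≟ i) ×-dec (l FP.≟ nxt i)) ⊎-dec ((j FP.≟ i) ×-dec (l FP.≟ nxt (nxt i))) ⊎-dec
     ((j FP.≟ nxt i) ×-dec (l FP.≟ nxt (nxt i)))))

triangle-orbit : ∀ (i m : Fin 3) → m ≡ i ⊎ m ≡ nxt i ⊎ m ≡ nxt (nxt i)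
triangle-orbit = from-yes (all? λ (i : Fin 3) → all? λ (m : Fin 3) → (m FP.≟ i) ⊎-dec (m FP.≟ nxt i) ⊎-dec (m FP.≟ nxt (nxt i)))

edge-opposite : ∀ (i : Fin 3) → incident (edge i) (vert (nxt (nxt i))) ≡ false × pathLen (edge i) (vert (nxt (nxt i))) ≡ 2
edge-opposite F.zero                   = refl , refl
edge-opposite (F.suc F.zero)           = refl , refl
edge-opposite (F.suc (F.suc F.zero))   = refl , refl

vertex-opposite : ∀ (i : Fin 3) → incident (vert i) (edge (nxt i)) ≡ false × pathLen (vert i) (edge (nxt i)) ≡ 2
vertex-opposite F.zero                 = refl , refl
vertex-opposite (F.suc F.zero)         = refl , refl
vertex-opposite (F.suc (F.suc F.zero)) = refl , refl

module SpanningTriangle {G : Graph 3} {c : Fin 3 → Fin 3} (CG : CircuitGraph G c) (i : Fin 3) where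
  open CircuitGraph CG

  P : List (Fin 3)
  P = c i ∷ c (nxt i) ∷ c (nxt (nxt i)) ∷ []

  spanning : ∀ x → inList P x ≡ true
  spanning x with m , refl ← injective⇒surjective c cycInj x with triangle-orbit i m
  ... | inj₁ refl        = ∨-introˡ (eqF-refl (c i))
  ... | inj₂ (inj₁ refl) = ∨-introʳ (eqF (c m) (c i)) (∨-introˡ (eqF-refl (c m)))
  ... | inj₂ (inj₂ refl) = ∨-introʳ (eqF (c m) (c i)) (∨-introʳ (eqF (c m) (c (nxt i))) (∨-introˡ (eqF-refl (c m))))

  isPath : IsPath G P (c i) (c (nxt (nxt i)))
  isPath = ((i≢i′ ∷ i≢i″ ∷ []) ∷ (i′≢i″ ∷ []) ∷ [] ∷ []) , (cycAdj i ∷ cycAdj (nxt i) ∷ [-]) , refl , refl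
    where
    i≢i′ : c i ≢ c (nxt i)
    i≢i′ = nxt≢ (s≤s z≤n) i ∘ sym ∘ cycInj i (nxt i)
    i′≢i″ : c (nxt i) ≢ c (nxt (nxt i))
    i′≢i″ = nxt≢ (s≤s z≤n) (nxt i) ∘ sym ∘ cycInj (nxt i) (nxt (nxt i))
    i≢i″ : c i ≢ c (nxt (nxt i))
    i≢i″ = nxt²≢ ℕP.≤-refl i ∘ sym ∘ cycInj i (nxt (nxt i))

  tuttePath : ∀ j → j ≡ i ⊎ j ≡ nxt i → ∀ {bound} → 0ℚ ℚ.≤ bound →
    BoundedCTuttePath G c (c i) (c (nxt (nxt i))) j bound
  tuttePath j j∈P {bound} 0≤bound =
    P , isPath , spanning⇒CTutte G c P spanning , on-path j∈P ,
    subst (λ b → + b / 1 ℚ.≤ bound) (sym (spanning⇒β≡0 G P spanning)) 0≤bound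
    where
    on-path : ∀ {j} → j ≡ i ⊎ j ≡ nxt i → pathEdge P (c j) (c (nxt j)) ≡ true
    on-path (inj₁ refl) = ∨-introˡ (∧-intro (eqF-refl (c i)) (eqF-refl (c (nxt i))))
    on-path (inj₂ refl) =
      ∨-introʳ (eqF (c i) (c (nxt i)) ∧ eqF (c (nxt i)) (c (nxt (nxt i))))
        (∨-introʳ (eqF (c i) (c (nxt (nxt i))) ∧ eqF (c (nxt i)) (c (nxt i)))
          (∨-introˡ (∧-intro (eqF-refl (c (nxt i))) (eqF-refl (c (nxt (nxt i)))))))

triangle-tuttePath-by-order : ∀ {G : Graph 3} {c : Fin 3 → Fin 3} → CircuitGraph G c →
  ∀ i j l → TriangleOrder i j l →
  ∀ {t₁ t₂ t₃} → Tau G c (vert l) (vert i) t₁ → Tau G c (vert i) (edge j) t₂ → Tau G c (edge j) (vert l) t₃ →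
  BoundedCTuttePath G c (c i) (c l) j (tutteBound 3 t₁ t₂ t₃)
triangle-tuttePath-by-order CG i _ _ (inj₁ (refl , refl)) τ₁ τ₂ τ₃ = CycleEdgePath.tuttePath CG i τ₁ τ₂ τ₃
triangle-tuttePath-by-order CG i _ _ (inj₂ (inj₁ (refl , refl))) τ₁ τ₂ τ₃ =
  SpanningTriangle.tuttePath CG i i (inj₁ refl)
    (QP.≤-trans (from-yes (0ℚ ℚ.≤? tutteBound 3 0ℚ ⅔ ⅓))
      (tutteBound-mono 3 3 QP.≤-refl (τ-nonneg τ₁) (QP.≤-reflexive (sym (τ-incident refl (∨-introˡ (eqF-refl i)) τ₂)))
                       (τ-pathLen2 refl (proj₁ (edge-opposite i)) (proj₂ (edge-opposite i)) τ₃)))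
triangle-tuttePath-by-order CG i _ _ (inj₂ (inj₂ (refl , refl))) τ₁ τ₂ τ₃ =
  SpanningTriangle.tuttePath CG i (nxt i) (inj₂ refl)
    (QP.≤-trans (from-yes (0ℚ ℚ.≤? tutteBound 3 0ℚ ⅓ ⅔))
      (tutteBound-mono 3 3 QP.≤-refl (τ-nonneg τ₁) (τ-pathLen2 refl (proj₁ (vertex-opposite i)) (proj₂ (vertex-opposite i)) τ₂)
                       (QP.≤-reflexive (sym (τ-incident refl (∨-introʳ (eqF (nxt (nxt i)) (nxt i)) (eqF-refl (nxt (nxt i)))) τ₃)))))

triangle-tuttePath : ∀ {k} {G : Graph 3} {c : Fin (suc k) → Fin 3} → CircuitGraph G c → k ≡ 2 →
  ∀ i j l → dist (vert i) (edge j) < dist (vert i) (vert l) →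
  ∀ {t₁ t₂ t₃} → Tau G c (vert l) (vert i) t₁ → Tau G c (vert i) (edge j) t₂ → Tau G c (edge j) (vert l) t₃ →
  BoundedCTuttePath G c (c i) (c l) j (tutteBound 3 t₁ t₂ t₃)
triangle-tuttePath CG refl i j l i→j→l = triangle-tuttePath-by-order CG i j l (triangle-order i j l i→j→l)

uv-tuttePath : ∀ {n k} {G : Graph n} {c : Fin (suc k) → Fin n} → CircuitGraph G c →
  ∀ {i j l} → j ≡ i → nxt j ≡ l →
  ∀ {t₁ t₂ t₃} → Tau G c (vert l) (vert i) t₁ → Tau G c (vert i) (edge j) t₂ → Tau G c (edge j) (vert l) t₃ →
  BoundedCTuttePath G c (c i) (c l) j (tutteBound n t₁ t₂ t₃)
uv-tuttePath CG refl refl = CycleEdgePath.tuttePath CG _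

vu-not-clockwise : ∀ {k} {i j l : Fin (suc k)} → j ≡ l → nxt j ≡ i → ¬ dist (vert i) (edge j) < dist (vert i) (vert l)
vu-not-clockwise {j = j} refl refl = ℕP.<-asym (dist-nxt-vert<dist-nxt-edge j)

lemma2p2 : (n : ℕ) → 3 ≤ n → (G : Graph n) →
    (k : ℕ) (c : Fin (suc k) → Fin n) → CircuitGraph G c →
    -- u = c i, e = c j c (nxt j), v = c l, occurring clockwise as u, e, v
    (i j l : Fin (suc k)) → i ≢ l →
    dist (vert i) (edge j) < dist (vert i) (vert l) →
    (((c j ≡ c i × c (nxt j) ≡ c l) ⊎ (c j ≡ c l × c (nxt j) ≡ c i)) ⊎ n ≡ 3) →
    (t₁ t₂ t₃ : ℚ) →
    Tau G c (vert l) (vert i) t₁ → Tau G c (vert i) (edge j) t₂ → Tau G c (edge j) (vert l) t₃ →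
    Σ (List (Fin n)) λ P →
      IsPath G P (c i) (c l) × CTutte G P c × pathEdge P (c j) (c (nxt j)) ≡ true ×
      (+ β G P / 1) ℚ.≤ (((+ n ℤ.- + 6) / 3) ℚ.+ t₁ ℚ.+ t₂ ℚ.+ t₃)
-- 3 ≤ n is also part of 2-connectivity, and i ≢ l already follows from the clockwise order.
lemma2p2 n _ G k c CG i j l _ _ (inj₁ (inj₁ (cj≡ci , cj′≡cl))) _ _ _ =
  uv-tuttePath CG (cycInj j i cj≡ci) (cycInj (nxt j) l cj′≡cl)
  where open CircuitGraph CG
lemma2p2 n _ G k c CG i j l _ i→j→l (inj₁ (inj₂ (cj≡cl , cj′≡ci))) _ _ _ _ _ _ =
  contradiction i→j→l (vu-not-clockwise (cycInj j l cj≡cl) (cycInj (nxt j) i cj′≡ci))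
  where open CircuitGraph CG
lemma2p2 .3 _ G k c CG i j l _ i→j→l (inj₂ refl) _ _ _ =
  triangle-tuttePath CG (circuit-on-3-vertices CG) i j l i→j→l
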